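{- Let $\xi_1,\xi_2,\dots$ and $\xi_1',\xi_2',\dots$ be independent Rademacher random variables, and for integers $0\le m\le n$ with $n$ even define \[\alpha(n,m)=\frac{\Pr[\xi_1+\cdots+\xi_n=0 \text{ and } \xi_1+\cdots+\xi_m+\xi_{m+1}'+\cdots+\xi_n'=0]}{\Pr[\xi_1+\cdots+\xi_n=0]^2}.\] If $n$ is even and $0\le m\le n^{1/2}$, then $\alpha(n,m)=1+O(m^2/n^2)$, where the implied constant is absolute.
   Context: A Rademacher random variable is uniform on $\{ -1,+1\}$. -}

module Defs where

open import Data.Bool using (Bool)
open import Data.Nat as ℕ using (ℕ; zero; suc)
open import Data.Integer as ℤ using (ℤ; +_)
open import Data.List using (List; []; _∷_; map; concatMap; filter; length; foldr; take; drop; _++_)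
open import Data.Product using (_×_; _,_)
open import Data.Rational as ℚ using (ℚ; 0ℚ)
open import Relation.Nullary using (does)
open import Relation.Unary using (Pred; Decidable)
open import Data.Bool using (T)

-- All outcomes of n independent Rademacher variables, as lists of
-- length n over {-1,+1}, each outcome listed exactly once (uniform measure).
signs : ℕ → List (List ℤ)
signs zero = [] ∷ []
signs (suc n) = concatMap (λ xs → (ℤ.+ 1 ∷ xs) ∷ (ℤ.- (ℤ.+ 1) ∷ xs) ∷ []) (signs n)

-- Sample space for (ξ₁..ξₙ, ξ'₁..ξ'ₙ): all pairs, uniform.
Ω : ℕ → List (List ℤ × List ℤ)
Ω n = concatMap (λ xs → map (λ ys → (xs , ys)) (signs n)) (signs n)

-- a / d as a rational (d is always positive in uses below; 0 if d = 0).
frac : ℕ → ℕ → ℚ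
frac a zero = 0ℚ
frac a (suc d) = (+ a) ℚ./ suc d

Pr : {A : Set} → List A → (A → Bool) → ℚ
Pr xs E = frac (length (filter (λ x → T? (E x)) xs)) (length xs)
  where
  open import Data.Bool.Properties using () renaming (T? to T?)

sumℤ : List ℤ → ℤ
sumℤ = foldr ℤ._+_ (+ 0)

isZero : ℤ → Bool
isZero s = does (s ℤ.≟ + 0)

E₁ : List ℤ × List ℤ → Bool
E₁ (xs , ys) = isZero (sumℤ xs)

E₂ : ℕ → List ℤ × List ℤ → Bool
E₂ m (xs , ys) = isZero (sumℤ (take m xs ++ drop m ys))

Eboth : ℕ → List ℤ × List ℤ → Bool
Eboth m ω = E₁ ω Data.Bool.∧ E₂ m ω

-- α(n,m) = Pr[E₁ ∧ E₂] / Pr[E₁]^2   (Pr[E₁] > 0 for n even; 0 returned otherwise)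
α : ℕ → ℕ → ℚ
α n m = ratio (Pr (Ω n) (Eboth m)) (Pr (Ω n) E₁ ℚ.* Pr (Ω n) E₁)
  where
  ratio : ℚ → ℚ → ℚ
  ratio p q with ℚ.↥ q
  ... | + zero = 0ℚ
  ... | ℤ.-[1+ _ ] = 0ℚ  -- impossible for probabilities (q ≥ 0)
  ... | + suc k = p ℚ.* ((ℚ.↧ q) ℚ./ suc k)

{-# OPTIONS --safe #-}

-- Write n = m + N and split the signs after the m-th. Let H(s) = C(N, (N + s)/2) be the
-- number of ways the last N signs bring a partial sum s back to 0, and let Sₖ = Σ H(s)ᵏ over
-- the 2ᵐ partial sums s of the first m signs. Then |E₁| = 2ⁿ S₁ and |E₁ ∩ E₂| = 2ᵐ S₂, so
-- α − 1 = (2ᵐ S₂ − S₁²)/S₁² is a normalised variance. The ratio recurrence of binomial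
-- coefficients shows that H stays within G s²/N of its peak G = H(N mod 2). Writing
-- H = G − D, the variance equals 2ᵐ Σ D² − (Σ D)², and the moments Σ s² = m 2ᵐ and
-- Σ s⁴ ≤ 3m² 2ᵐ bound it by 12 m² S₁²/N² once N ≥ 2m, which also gives S₁ ≥ 2ᵐ G/2.
-- Hence n² |α − 1| ≤ 48 m². Under m² ≤ n the only cases with N < 2m are
-- (n, m) = (0, 0), (2, 1), (4, 2), which are computed.

module Submission where

open import Defs
open import Data.Bool using (Bool; true; false; _∧_)
open import Data.Bool.Properties using (T?)
open import Data.Integer
  using (ℤ; +_; -[1+_]; 0ℤ; 1ℤ; -1ℤ; _+_; _*_; _-_; -_; _^_; ∣_∣; _≤_; _<_; _≤?_; +≤+; +<+; nonNegative; positive)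
open import Data.Integer.Properties
  using ( +-identityˡ; +-identityʳ; +-assoc; +-comm; *-comm; *-assoc; *-identityˡ; *-identityʳ; *-zeroˡ; *-zeroʳ; *-distribˡ-+
        ; +-inverseʳ; neg-distrib-+; neg-distribˡ-*; +-mono-≤; +-monoʳ-≤; +-mono-≤-<; ≤-refl; ≤-trans; i≤i+j; i≤j+i
        ; i≤j⇒0≤j-i; drop‿+≤+; pos-*; abs-*; *-cancelʳ-≡; *-monoˡ-≤-nonNeg; *-monoʳ-≤-nonNeg; *-cancelˡ-≤-pos; module ≤-Reasoning )
open import Data.Integer.Tactic.RingSolver using (solve-∀)
open import Data.Rational as ℚ using (ℚ; mkℚ; 1ℚ; toℚᵘ)
import Data.Rational.Properties as ℚ
open import Data.Rational.Unnormalised as ℚᵘ using (ℚᵘ; mkℚᵘ; *≡*; *≤*)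
import Data.Rational.Unnormalised.Properties as ℚᵘ
open import Data.List using (List; []; _∷_; _++_; map; concatMap; filter; length; take; drop)
open import Data.List.Properties using (take++drop≡id; length-filter)
open import Data.Nat as ℕ using (ℕ; zero; suc; z≤n; s≤s)
import Data.Nat.Coprimality as Coprime
import Data.Nat.Properties as ℕ
open import Data.Nat.DivMod using (m≡m%n+[m/n]*n; m%n<n)
open import Data.Nat.Divisibility using (_∣_; _∣?_; divides)
import Data.Nat.Tactic.RingSolver as ℕ-Ring
open import Data.Product using (_×_; _,_; proj₁; proj₂; ∃-syntax)
open import Data.Sum using (_⊎_; inj₁; inj₂)
open import Relation.Nullary.Decidable using (toWitness; from-no)
open import Relation.Nullary.Negation using (contradiction)
open import Function using (_∘_)
open import Relation.Binary.PropositionalEquality hiding ([_])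

private
  variable
    X Y : Set

≤-by-gap : ∀ {a b} d → b ≡ a + d → 0ℤ ≤ d → a ≤ b
≤-by-gap {a} d b≡a+d 0≤d = subst (a ≤_) (sym b≡a+d) (i≤i+j a d ⦃ nonNegative 0≤d ⦄)

*-monoˡ-≤-≥0 : ∀ {a b c} → 0ℤ ≤ c → a ≤ b → c * a ≤ c * b
*-monoˡ-≤-≥0 {c = c} 0≤c = *-monoˡ-≤-nonNeg c ⦃ nonNegative 0≤c ⦄

*-monoʳ-≤-≥0 : ∀ {a b c} → 0ℤ ≤ c → a ≤ b → a * c ≤ b * c
*-monoʳ-≤-≥0 {c = c} 0≤c = *-monoʳ-≤-nonNeg c ⦃ nonNegative 0≤c ⦄

*-≥0 : ∀ {a b} → 0ℤ ≤ a → 0ℤ ≤ b → 0ℤ ≤ a * b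
*-≥0 {a} {b} 0≤a 0≤b = subst (_≤ a * b) (*-zeroˡ b) (*-monoʳ-≤-≥0 0≤b 0≤a)

*-mono-≤-≥0 : ∀ {a b c d} → 0ℤ ≤ a → 0ℤ ≤ c → a ≤ b → c ≤ d → a * c ≤ b * d
*-mono-≤-≥0 0≤a 0≤c a≤b c≤d = ≤-trans (*-monoʳ-≤-≥0 0≤c a≤b) (*-monoˡ-≤-≥0 (≤-trans 0≤a a≤b) c≤d)

square-≥0 : ∀ a → 0ℤ ≤ a * a
square-≥0 (+ n) = *-≥0 (+≤+ {0} {n} z≤n) (+≤+ {0} {n} z≤n)
square-≥0 -[1+ n ] = +≤+ z≤n

1≤2^ : ∀ m → 1ℤ ≤ (+ 2) ^ m
1≤2^ zero = ≤-refl
1≤2^ (suc m) = ≤-trans (1≤2^ m) (≤-by-gap ((+ 2) ^ m) (double ((+ 2) ^ m)) (≤-trans (+≤+ z≤n) (1≤2^ m)))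
  where
  double : ∀ a → + 2 * a ≡ a + a
  double = solve-∀

1≤2x⇒1≤x : ∀ x → 1ℤ ≤ + 2 * x → 1ℤ ≤ x
1≤2x⇒1≤x (+ suc k) _ = +≤+ (s≤s z≤n)
1≤2x⇒1≤x (+ zero) (+≤+ ())
1≤2x⇒1≤x -[1+ k ] ()

*-∣∣-≤ : ∀ {c b} x → c * x ≤ b → c * - x ≤ b → c * + ∣ x ∣ ≤ b
*-∣∣-≤ (+ k) cx≤b _ = cx≤b
*-∣∣-≤ -[1+ k ] _ c[-x]≤b = c[-x]≤b

+∣*∣ : ∀ t x → 0ℤ ≤ t → + ∣ t * x ∣ ≡ t * + ∣ x ∣
+∣*∣ (+ j) x _ = trans (cong +_ (abs-* (+ j) x)) (pos-* j ∣ x ∣)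

∑ : (X → ℤ) → List X → ℤ
∑ f [] = 0ℤ
∑ f (x ∷ xs) = f x + ∑ f xs

∑-cong : {f g : X → ℤ} → (∀ x → f x ≡ g x) → ∀ xs → ∑ f xs ≡ ∑ g xs
∑-cong f≗g [] = refl
∑-cong f≗g (x ∷ xs) = cong₂ _+_ (f≗g x) (∑-cong f≗g xs)

∑-++ : (f : X → ℤ) (xs ys : List X) → ∑ f (xs ++ ys) ≡ ∑ f xs + ∑ f ys
∑-++ f [] ys = sym (+-identityˡ _)
∑-++ f (x ∷ xs) ys = trans (cong (_+_ (f x)) (∑-++ f xs ys)) (sym (+-assoc (f x) _ _))

∑-+ : (f g : X → ℤ) (xs : List X) → ∑ (λ x → f x + g x) xs ≡ ∑ f xs + ∑ g xs
∑-+ f g [] = refl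
∑-+ f g (x ∷ xs) = trans (cong (_+_ (f x + g x)) (∑-+ f g xs)) (swap (f x) (g x) _ _)
  where
  swap : ∀ a b c d → a + b + (c + d) ≡ a + c + (b + d)
  swap = solve-∀

∑-*ˡ : (c : ℤ) (f : X → ℤ) (xs : List X) → ∑ (λ x → c * f x) xs ≡ c * ∑ f xs
∑-*ˡ c f [] = sym (*-zeroʳ c)
∑-*ˡ c f (x ∷ xs) = trans (cong (_+_ (c * f x)) (∑-*ˡ c f xs)) (sym (*-distribˡ-+ c (f x) _))

∑-concatMap : (f : Y → ℤ) (g : X → List Y) (xs : List X) →
              ∑ f (concatMap g xs) ≡ ∑ (∑ f ∘ g) xs
∑-concatMap f g [] = refl
∑-concatMap f g (x ∷ xs) = trans (∑-++ f (g x) _) (cong (_+_ (∑ f (g x))) (∑-concatMap f g xs))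

∑-map : (f : Y → ℤ) (g : X → Y) (xs : List X) → ∑ f (map g xs) ≡ ∑ (f ∘ g) xs
∑-map f g [] = refl
∑-map f g (x ∷ xs) = cong (_+_ (f (g x))) (∑-map f g xs)

𝟙 : Bool → ℤ
𝟙 true = 1ℤ
𝟙 false = 0ℤ

𝟙-∧ : ∀ a b → 𝟙 (a ∧ b) ≡ 𝟙 a * 𝟙 b
𝟙-∧ true true = refl
𝟙-∧ true false = refl
𝟙-∧ false b = refl

count : (X → Bool) → List X → ℕ
count E xs = length (filter (T? ∘ E) xs)

count-∑ : (E : X → Bool) (xs : List X) → + count E xs ≡ ∑ (𝟙 ∘ E) xs
count-∑ E [] = refl
count-∑ E (x ∷ xs) with E x
... | true = cong (_+_ 1ℤ) (count-∑ E xs)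
... | false = trans (count-∑ E xs) (sym (+-identityˡ _))

length-∑ : (xs : List X) → + length xs ≡ ∑ (λ _ → 1ℤ) xs
length-∑ [] = refl
length-∑ (x ∷ xs) = cong (_+_ 1ℤ) (length-∑ xs)

sumℤ-++ : (u v : List ℤ) → sumℤ (u ++ v) ≡ sumℤ u + sumℤ v
sumℤ-++ [] v = sym (+-identityˡ _)
sumℤ-++ (x ∷ u) v = trans (cong (_+_ x) (sumℤ-++ u v)) (sym (+-assoc x _ _))

∑-signs-suc : (f : List ℤ → ℤ) (k : ℕ) →
              ∑ f (signs (suc k)) ≡ ∑ (λ w → f (1ℤ ∷ w) + f (-1ℤ ∷ w)) (signs k)
∑-signs-suc f k =
  trans (∑-concatMap f _ (signs k)) (∑-cong (λ w → cong (_+_ (f (1ℤ ∷ w))) (+-identityʳ _)) (signs k))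

∑-signs-split : ∀ m N (Q : List ℤ → List ℤ → ℤ) →
                ∑ (λ xs → Q (take m xs) (drop m xs)) (signs (m ℕ.+ N)) ≡ ∑ (λ u → ∑ (Q u) (signs N)) (signs m)
∑-signs-split zero N Q = sym (+-identityʳ _)
∑-signs-split (suc m) N Q = begin
  ∑ (λ xs → Q (take (suc m) xs) (drop (suc m) xs)) (signs (suc m ℕ.+ N))
    ≡⟨ ∑-signs-suc _ (m ℕ.+ N) ⟩
  ∑ (λ w → Q (1ℤ ∷ take m w) (drop m w) + Q (-1ℤ ∷ take m w) (drop m w)) (signs (m ℕ.+ N))
    ≡⟨ ∑-+ _ _ (signs (m ℕ.+ N)) ⟩
  ∑ (λ w → Q (1ℤ ∷ take m w) (drop m w)) (signs (m ℕ.+ N)) + ∑ (λ w → Q (-1ℤ ∷ take m w) (drop m w)) (signs (m ℕ.+ N))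
    ≡⟨ cong₂ _+_ (∑-signs-split m N (Q ∘ (1ℤ ∷_))) (∑-signs-split m N (Q ∘ (-1ℤ ∷_))) ⟩
  ∑ (λ u → ∑ (Q (1ℤ ∷ u)) (signs N)) (signs m) + ∑ (λ u → ∑ (Q (-1ℤ ∷ u)) (signs N)) (signs m)
    ≡⟨ ∑-+ _ _ (signs m) ⟨
  ∑ (λ u → ∑ (Q (1ℤ ∷ u)) (signs N) + ∑ (Q (-1ℤ ∷ u)) (signs N)) (signs m)
    ≡⟨ ∑-signs-suc (λ u → ∑ (Q u) (signs N)) m ⟨
  ∑ (λ u → ∑ (Q u) (signs N)) (signs (suc m)) ∎
  where open ≡-Reasoning

walk : ℕ → (ℤ → ℤ) → ℤ → ℤ
walk zero f t = f t
walk (suc m) f t = walk m f (t + 1ℤ) + walk m f (t - 1ℤ)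

walk-cong : ∀ m {f g : ℤ → ℤ} → (∀ s → f s ≡ g s) → ∀ t → walk m f t ≡ walk m g t
walk-cong zero f≗g t = f≗g t
walk-cong (suc m) f≗g t = cong₂ _+_ (walk-cong m f≗g (t + 1ℤ)) (walk-cong m f≗g (t - 1ℤ))

walk-+ : ∀ m (f g : ℤ → ℤ) t → walk m (λ s → f s + g s) t ≡ walk m f t + walk m g t
walk-+ zero f g t = refl
walk-+ (suc m) f g t =
  trans (cong₂ _+_ (walk-+ m f g (t + 1ℤ)) (walk-+ m f g (t - 1ℤ)))
        (swap (walk m f (t + 1ℤ)) (walk m g (t + 1ℤ)) (walk m f (t - 1ℤ)) (walk m g (t - 1ℤ)))
  where
  swap : ∀ a b c d → a + b + (c + d) ≡ a + c + (b + d)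
  swap = solve-∀

walk-*ˡ : ∀ m c (f : ℤ → ℤ) t → walk m (λ s → c * f s) t ≡ c * walk m f t
walk-*ˡ zero c f t = refl
walk-*ˡ (suc m) c f t =
  trans (cong₂ _+_ (walk-*ˡ m c f (t + 1ℤ)) (walk-*ˡ m c f (t - 1ℤ)))
        (sym (*-distribˡ-+ c (walk m f (t + 1ℤ)) (walk m f (t - 1ℤ))))

walk-neg : ∀ m (f : ℤ → ℤ) t → walk m (λ s → - f s) t ≡ - walk m f t
walk-neg zero f t = refl
walk-neg (suc m) f t =
  trans (cong₂ _+_ (walk-neg m f (t + 1ℤ)) (walk-neg m f (t - 1ℤ)))
        (sym (neg-distrib-+ (walk m f (t + 1ℤ)) (walk m f (t - 1ℤ))))

walk-const : ∀ m c t → walk m (λ _ → c) t ≡ (+ 2) ^ m * c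
walk-const zero c t = sym (*-identityˡ c)
walk-const (suc m) c t =
  trans (cong₂ _+_ (walk-const m c (t + 1ℤ)) (walk-const m c (t - 1ℤ))) (double ((+ 2) ^ m) c)
  where
  double : ∀ a c → a * c + a * c ≡ + 2 * a * c
  double = solve-∀

walk-mono : ∀ m {f g : ℤ → ℤ} t → (∀ k → f (t + + m + + 2 * k) ≤ g (t + + m + + 2 * k)) →
            walk m f t ≤ walk m g t
walk-mono zero {f} {g} t f≤g = subst (λ s → f s ≤ g s) (start t) (f≤g 0ℤ)
  where
  start : ∀ t → t + 0ℤ + + 2 * 0ℤ ≡ t
  start = solve-∀
walk-mono (suc m) {f} {g} t f≤g = +-mono-≤
  (walk-mono m (t + 1ℤ) (λ k → subst (λ s → f s ≤ g s) (up t (+ m) k) (f≤g k)))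
  (walk-mono m (t - 1ℤ) (λ k → subst (λ s → f s ≤ g s) (down t (+ m) k) (f≤g (k - 1ℤ))))
  where
  up : ∀ t m k → t + (1ℤ + m) + + 2 * k ≡ t + 1ℤ + m + + 2 * k
  up = solve-∀
  down : ∀ t m k → t + (1ℤ + m) + + 2 * (k - 1ℤ) ≡ t - 1ℤ + m + + 2 * k
  down = solve-∀

walk-nonneg : ∀ m {f : ℤ → ℤ} t → (∀ k → 0ℤ ≤ f (t + + m + + 2 * k)) → 0ℤ ≤ walk m f t
walk-nonneg m {f} t 0≤f =
  subst (_≤ walk m f t) (trans (walk-const m 0ℤ t) (*-zeroʳ ((+ 2) ^ m))) (walk-mono m t 0≤f)

walk-compose : ∀ m N f t → walk (m ℕ.+ N) f t ≡ walk m (walk N f) t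
walk-compose zero N f t = refl
walk-compose (suc m) N f t = cong₂ _+_ (walk-compose m N f (t + 1ℤ)) (walk-compose m N f (t - 1ℤ))

walk-even : ∀ m {f : ℤ → ℤ} → (∀ s → f (- s) ≡ f s) → ∀ t → walk m f (- t) ≡ walk m f t
walk-even zero f-even t = f-even t
walk-even (suc m) {f} f-even t = begin
  walk m f (- t + 1ℤ) + walk m f (- t - 1ℤ)     ≡⟨ cong₂ (λ u v → walk m f u + walk m f v) (flip₁ t) (flip₂ t) ⟩
  walk m f (- (t - 1ℤ)) + walk m f (- (t + 1ℤ)) ≡⟨ cong₂ _+_ (walk-even m f-even (t - 1ℤ)) (walk-even m f-even (t + 1ℤ)) ⟩
  walk m f (t - 1ℤ) + walk m f (t + 1ℤ)         ≡⟨ +-comm (walk m f (t - 1ℤ)) _ ⟩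
  walk m f (t + 1ℤ) + walk m f (t - 1ℤ)         ∎
  where
  open ≡-Reasoning
  flip₁ : ∀ t → - t + 1ℤ ≡ - (t - 1ℤ)
  flip₁ = solve-∀
  flip₂ : ∀ t → - t - 1ℤ ≡ - (t + 1ℤ)
  flip₂ = solve-∀

walk-square : ∀ m t → walk m (λ s → s * s) t ≡ (+ 2) ^ m * (t * t + + m)
walk-square zero t = sym (trans (*-identityˡ _) (+-identityʳ _))
walk-square (suc m) t =
  trans (cong₂ _+_ (walk-square m (t + 1ℤ)) (walk-square m (t - 1ℤ))) (step ((+ 2) ^ m) t (+ m))
  where
  step : ∀ a t m → a * ((t + 1ℤ) * (t + 1ℤ) + m) + a * ((t - 1ℤ) * (t - 1ℤ) + m) ≡ + 2 * a * (t * t + (1ℤ + m))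
  step = solve-∀

walk-fourth : ∀ m t → walk m (λ s → s * s * (s * s)) t ≡
              (+ 2) ^ m * (t * t * (t * t) + + 6 * + m * (t * t) + + 3 * + m * + m - + 2 * + m)
walk-fourth zero t = sym (trans (*-identityˡ _) (fourth t))
  where
  fourth : ∀ t → t * t * (t * t) + + 6 * 0ℤ * (t * t) + + 3 * 0ℤ * 0ℤ - + 2 * 0ℤ ≡ t * t * (t * t)
  fourth = solve-∀
walk-fourth (suc m) t =
  trans (cong₂ _+_ (walk-fourth m (t + 1ℤ)) (walk-fourth m (t - 1ℤ))) (step ((+ 2) ^ m) t (+ m))
  where
  step : ∀ a t m →
         a * ((t + 1ℤ) * (t + 1ℤ) * ((t + 1ℤ) * (t + 1ℤ)) + + 6 * m * ((t + 1ℤ) * (t + 1ℤ)) + + 3 * m * m - + 2 * m)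
       + a * ((t - 1ℤ) * (t - 1ℤ) * ((t - 1ℤ) * (t - 1ℤ)) + + 6 * m * ((t - 1ℤ) * (t - 1ℤ)) + + 3 * m * m - + 2 * m)
       ≡ + 2 * a * (t * t * (t * t) + + 6 * (1ℤ + m) * (t * t) + + 3 * (1ℤ + m) * (1ℤ + m) - + 2 * (1ℤ + m))
  step = solve-∀

walk-const-sub : ∀ m (h : ℤ → ℤ) c t → walk m (λ s → c - h s) t ≡ (+ 2) ^ m * c - walk m h t
walk-const-sub m h c t = trans (walk-+ m (λ _ → c) (λ s → - h s) t) (cong₂ _+_ (walk-const m c t) (walk-neg m h t))

walk-variance-shift : ∀ m (h : ℤ → ℤ) c t →
  (+ 2) ^ m * walk m (λ s → h s * h s) t - walk m h t * walk m h t ≡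
  (+ 2) ^ m * walk m (λ s → (c - h s) * (c - h s)) t - walk m (λ s → c - h s) t * walk m (λ s → c - h s) t
walk-variance-shift m h c t =
  sym (trans (cong₂ (λ u v → a * u - v * v) second (walk-const-sub m h c t)) (cancel a c W₁ W₂))
  where
  a = (+ 2) ^ m
  W₁ = walk m h t
  W₂ = walk m (λ s → h s * h s) t
  expand : ∀ c h → (c - h) * (c - h) ≡ c * c + (- (+ 2 * c) * h + h * h)
  expand = solve-∀
  second : walk m (λ s → (c - h s) * (c - h s)) t ≡ a * (c * c) + (- (+ 2 * c) * W₁ + W₂)
  second = begin
    walk m (λ s → (c - h s) * (c - h s)) t
      ≡⟨ walk-cong m (λ s → expand c (h s)) t ⟩
    walk m (λ s → c * c + (- (+ 2 * c) * h s + h s * h s)) t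
      ≡⟨ walk-+ m (λ _ → c * c) _ t ⟩
    walk m (λ _ → c * c) t + walk m (λ s → - (+ 2 * c) * h s + h s * h s) t
      ≡⟨ cong₂ _+_ (walk-const m (c * c) t) (walk-+ m (λ s → - (+ 2 * c) * h s) (λ s → h s * h s) t) ⟩
    a * (c * c) + (walk m (λ s → - (+ 2 * c) * h s) t + W₂)
      ≡⟨ cong (λ u → a * (c * c) + (u + W₂)) (walk-*ˡ m (- (+ 2 * c)) h t) ⟩
    a * (c * c) + (- (+ 2 * c) * W₁ + W₂) ∎
    where open ≡-Reasoning
  cancel : ∀ a c w₁ w₂ → a * (a * (c * c) + (- (+ 2 * c) * w₁ + w₂)) - (a * c - w₁) * (a * c - w₁) ≡ a * w₂ - w₁ * w₁
  cancel = solve-∀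

∑-signs-walk : ∀ k (f : ℤ → ℤ) t → ∑ (λ u → f (t + sumℤ u)) (signs k) ≡ walk k f t
∑-signs-walk zero f t = trans (+-identityʳ _) (cong f (+-identityʳ t))
∑-signs-walk (suc k) f t = begin
  ∑ (λ u → f (t + sumℤ u)) (signs (suc k))
    ≡⟨ ∑-signs-suc _ k ⟩
  ∑ (λ w → f (t + (1ℤ + sumℤ w)) + f (t + (-1ℤ + sumℤ w))) (signs k)
    ≡⟨ ∑-cong (λ w → cong₂ _+_ (cong f (sym (+-assoc t 1ℤ _))) (cong f (sym (+-assoc t -1ℤ _)))) (signs k) ⟩
  ∑ (λ w → f (t + 1ℤ + sumℤ w) + f (t - 1ℤ + sumℤ w)) (signs k)
    ≡⟨ ∑-+ _ _ (signs k) ⟩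
  ∑ (λ w → f (t + 1ℤ + sumℤ w)) (signs k) + ∑ (λ w → f (t - 1ℤ + sumℤ w)) (signs k)
    ≡⟨ cong₂ _+_ (∑-signs-walk k f (t + 1ℤ)) (∑-signs-walk k f (t - 1ℤ)) ⟩
  walk (suc k) f t ∎
  where open ≡-Reasoning

∑-Ω : ∀ n (g : List ℤ × List ℤ → ℤ) → ∑ g (Ω n) ≡ ∑ (λ xs → ∑ (λ ys → g (xs , ys)) (signs n)) (signs n)
∑-Ω n g = trans (∑-concatMap g _ (signs n)) (∑-cong (λ xs → ∑-map g _ (signs n)) (signs n))

∑-signs-const : ∀ k c → ∑ (λ _ → c) (signs k) ≡ (+ 2) ^ k * c
∑-signs-const k c = trans (∑-signs-walk k (λ _ → c) 0ℤ) (walk-const k c 0ℤ)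

∑-signs-sum : ∀ k (f : ℤ → ℤ) → ∑ (f ∘ sumℤ) (signs k) ≡ walk k f 0ℤ
∑-signs-sum k f = trans (∑-cong (λ u → cong f (sym (+-identityˡ (sumℤ u)))) (signs k)) (∑-signs-walk k f 0ℤ)

∑-signs-replace-prefix : ∀ m N (g : ℤ → ℤ) u →
                 ∑ (λ ys → g (sumℤ (u ++ drop m ys))) (signs (m ℕ.+ N)) ≡ (+ 2) ^ m * walk N g (sumℤ u)
∑-signs-replace-prefix m N g u = begin
  ∑ (λ ys → g (sumℤ (u ++ drop m ys))) (signs (m ℕ.+ N))       ≡⟨ ∑-signs-split m N (λ _ v → g (sumℤ (u ++ v))) ⟩
  ∑ (λ _ → ∑ (λ v → g (sumℤ (u ++ v))) (signs N)) (signs m)     ≡⟨ ∑-signs-const m _ ⟩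
  (+ 2) ^ m * ∑ (λ v → g (sumℤ (u ++ v))) (signs N)             ≡⟨ cong ((+ 2) ^ m *_) (∑-cong (λ v → cong g (sumℤ-++ u v)) (signs N)) ⟩
  (+ 2) ^ m * ∑ (λ v → g (sumℤ u + sumℤ v)) (signs N)           ≡⟨ cong ((+ 2) ^ m *_) (∑-signs-walk N g (sumℤ u)) ⟩
  (+ 2) ^ m * walk N g (sumℤ u)                                 ∎
  where open ≡-Reasoning

∑-signs-take : ∀ m N (F : ℤ → ℤ → ℤ) →
               ∑ (λ xs → F (sumℤ (take m xs)) (sumℤ xs)) (signs (m ℕ.+ N)) ≡ walk m (λ s → walk N (F s) s) 0ℤ
∑-signs-take m N F = begin
  ∑ (λ xs → F (sumℤ (take m xs)) (sumℤ xs)) (signs (m ℕ.+ N))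
    ≡⟨ ∑-cong (λ xs → cong (F (sumℤ (take m xs)) ∘ sumℤ) (sym (take++drop≡id m xs))) (signs (m ℕ.+ N)) ⟩
  ∑ (λ xs → F (sumℤ (take m xs)) (sumℤ (take m xs ++ drop m xs))) (signs (m ℕ.+ N))
    ≡⟨ ∑-signs-split m N (λ u v → F (sumℤ u) (sumℤ (u ++ v))) ⟩
  ∑ (λ u → ∑ (λ v → F (sumℤ u) (sumℤ (u ++ v))) (signs N)) (signs m)
    ≡⟨ ∑-cong (λ u → ∑-cong (λ v → cong (F (sumℤ u)) (sumℤ-++ u v)) (signs N)) (signs m) ⟩
  ∑ (λ u → ∑ (λ v → F (sumℤ u) (sumℤ u + sumℤ v)) (signs N)) (signs m)
    ≡⟨ ∑-cong (λ u → ∑-signs-walk N (F (sumℤ u)) (sumℤ u)) (signs m) ⟩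
  ∑ (λ u → walk N (F (sumℤ u)) (sumℤ u)) (signs m)
    ≡⟨ ∑-signs-sum m (λ s → walk N (F s) s) ⟩
  walk m (λ s → walk N (F s) s) 0ℤ ∎
  where open ≡-Reasoning

δ : ℤ → ℤ
δ s = 𝟙 (isZero s)

δ-nonneg : ∀ s → 0ℤ ≤ δ s
δ-nonneg s with isZero s
... | true = +≤+ z≤n
... | false = +≤+ z≤n

δ-even : ∀ s → δ (- s) ≡ δ s
δ-even (+ zero) = refl
δ-even (+ suc n) = refl
δ-even -[1+ n ] = refl

*-δ : ∀ s → s * δ s ≡ 0ℤ
*-δ (+ zero) = refl
*-δ (+ suc n) = *-zeroʳ (+ suc n)
*-δ -[1+ n ] = *-zeroʳ -[1+ n ]

-- paths N s is the number of ±1 walks of length N from s to 0, i.e. C(N, (N + s)/2)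
-- when N + s is even and 0 otherwise.
paths : ℕ → ℤ → ℤ
paths N = walk N δ

paths-nonneg : ∀ N s → 0ℤ ≤ paths N s
paths-nonneg N s = walk-nonneg N s (λ k → δ-nonneg (s + + N + + 2 * k))

paths-even : ∀ N s → paths N (- s) ≡ paths N s
paths-even N = walk-even N δ-even

paths-top : ∀ N → 1ℤ ≤ paths N (+ N)
paths-top zero = ≤-refl
paths-top (suc N) = ≤-trans (paths-top N) (i≤j+i (paths N (+ N)) _ ⦃ nonNegative (paths-nonneg N _) ⦄)

ratio-step : ∀ n s a b c → (n + (s + 1ℤ) + + 2) * a ≡ (n - (s + 1ℤ)) * b → (n + (s - 1ℤ) + + 2) * b ≡ (n - (s - 1ℤ)) * c →
             (1ℤ + n + s + + 2) * (a + b) ≡ (1ℤ + n - s) * (b + c)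
ratio-step n s a b c ratio₁ ratio₂ = begin
  (1ℤ + n + s + + 2) * (a + b)                               ≡⟨ expand₁ n s a b ⟩
  (n + (s + 1ℤ) + + 2) * a + (n + (s + 1ℤ) + + 2) * b        ≡⟨ cong (_+ (n + (s + 1ℤ) + + 2) * b) ratio₁ ⟩
  (n - (s + 1ℤ)) * b + (n + (s + 1ℤ) + + 2) * b              ≡⟨ regroup n s b ⟩
  (n + (s - 1ℤ) + + 2) * b + (n - (s - 1ℤ)) * b              ≡⟨ cong (_+ (n - (s - 1ℤ)) * b) ratio₂ ⟩
  (n - (s - 1ℤ)) * c + (n - (s - 1ℤ)) * b                    ≡⟨ collect n s b c ⟩
  (1ℤ + n - s) * (b + c)                                     ∎
  where
  open ≡-Reasoning
  expand₁ : ∀ n s a b → (1ℤ + n + s + + 2) * (a + b) ≡ (n + (s + 1ℤ) + + 2) * a + (n + (s + 1ℤ) + + 2) * b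
  expand₁ = solve-∀
  regroup : ∀ n s b → (n - (s + 1ℤ)) * b + (n + (s + 1ℤ) + + 2) * b ≡ (n + (s - 1ℤ) + + 2) * b + (n - (s - 1ℤ)) * b
  regroup = solve-∀
  collect : ∀ n s b c → (n - (s - 1ℤ)) * c + (n - (s - 1ℤ)) * b ≡ (1ℤ + n - s) * (b + c)
  collect = solve-∀

-- Twice the identity (N − j + 1) C(N, j − 1) = j C(N, j), where j = (N − s)/2.
paths-ratio : ∀ N s → (+ N + s + + 2) * paths N (s + + 2) ≡ (+ N - s) * paths N s
paths-ratio zero s = begin
  (0ℤ + s + + 2) * δ (s + + 2) ≡⟨ cong (λ u → (u + + 2) * δ (s + + 2)) (+-identityˡ s) ⟩
  (s + + 2) * δ (s + + 2)      ≡⟨ *-δ (s + + 2) ⟩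
  0ℤ                           ≡⟨ cong -_ (*-δ s) ⟨
  - (s * δ s)                  ≡⟨ neg-distribˡ-* s (δ s) ⟩
  - s * δ s                    ≡⟨ cong (_* δ s) (+-identityˡ (- s)) ⟨
  (0ℤ - s) * δ s               ∎
  where open ≡-Reasoning
paths-ratio (suc N) s = begin
  (+ suc N + s + + 2) * (paths N (s + + 2 + 1ℤ) + paths N (s + + 2 - 1ℤ))
    ≡⟨ cong₂ (λ u v → (+ suc N + s + + 2) * (paths N u + paths N v)) (shift₁ s) (shift₂ s) ⟩
  (+ suc N + s + + 2) * (paths N (s + 1ℤ + + 2) + paths N (s + 1ℤ))
    ≡⟨ ratio-step (+ N) s _ _ _ (paths-ratio N (s + 1ℤ)) (trans (cong (λ u → (+ N + (s - 1ℤ) + + 2) * paths N u) (shift₃ s)) (paths-ratio N (s - 1ℤ))) ⟩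
  (+ suc N - s) * (paths N (s + 1ℤ) + paths N (s - 1ℤ)) ∎
  where
  open ≡-Reasoning
  shift₁ : ∀ s → s + + 2 + 1ℤ ≡ s + 1ℤ + + 2
  shift₁ = solve-∀
  shift₂ : ∀ s → s + + 2 - 1ℤ ≡ s + 1ℤ
  shift₂ = solve-∀
  shift₃ : ∀ s → s + 1ℤ ≡ s - 1ℤ + + 2
  shift₃ = solve-∀

module _ (N : ℕ) {s : ℤ} (0≤s : 0ℤ ≤ s) where

  private
    N+s+2>0 : 0ℤ < + N + s + + 2
    N+s+2>0 = +-mono-≤-< (+-mono-≤ (+≤+ {0} {N} z≤n) 0≤s) (+<+ (s≤s z≤n))

  paths-antitone : paths N (s + + 2) ≤ paths N s
  paths-antitone = *-cancelˡ-≤-pos _ _ (+ N + s + + 2) ⦃ positive N+s+2>0 ⦄ (begin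
    (+ N + s + + 2) * paths N (s + + 2) ≡⟨ paths-ratio N s ⟩
    (+ N - s) * paths N s               ≤⟨ *-monoʳ-≤-≥0 (paths-nonneg N s) (≤-by-gap {+ N - s} (s + s + + 2) (gap (+ N) s) (+-mono-≤ (+-mono-≤ 0≤s 0≤s) (+≤+ {0} {2} z≤n))) ⟩
    (+ N + s + + 2) * paths N s         ∎)
    where
    open ≤-Reasoning
    gap : ∀ n s → n + s + + 2 ≡ n - s + (s + s + + 2)
    gap = solve-∀

  paths-decrement : + N * (paths N s - paths N (s + + 2)) ≤ (s + s + + 2) * paths N s
  paths-decrement = begin
    + N * (paths N s - paths N (s + + 2))               ≤⟨ *-monoʳ-≤-≥0 (i≤j⇒0≤j-i paths-antitone) (i≤i+j (+ N) (s + + 2) ⦃ nonNegative (+-mono-≤ 0≤s (+≤+ {0} {2} z≤n)) ⦄) ⟩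
    (+ N + (s + + 2)) * (paths N s - paths N (s + + 2)) ≡⟨ expand (+ N) s (paths N s) (paths N (s + + 2)) ⟩
    (+ N + s + + 2) * paths N s - (+ N + s + + 2) * paths N (s + + 2) ≡⟨ cong (λ u → (+ N + s + + 2) * paths N s - u) (paths-ratio N s) ⟩
    (+ N + s + + 2) * paths N s - (+ N - s) * paths N s ≡⟨ cancel (+ N) s (paths N s) ⟩
    (s + s + + 2) * paths N s                           ∎
    where
    open ≤-Reasoning
    expand : ∀ n s p q → (n + (s + + 2)) * (p - q) ≡ (n + s + + 2) * p - (n + s + + 2) * q
    expand = solve-∀
    cancel : ∀ n s p → (n + s + + 2) * p - (n - s) * p ≡ (s + s + + 2) * p
    cancel = solve-∀

NearPeak : ℕ → ℤ → (ℤ → ℤ) → ℤ → Set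
NearPeak N G h s = h s ≤ G × + N * (G - h s) ≤ G * (s * s)

NearPeak-neg : ∀ {N G h s} → h (- s) ≡ h s → NearPeak N G h s → NearPeak N G h (- s)
NearPeak-neg {N} {G} {h} {s} h-even (h≤G , gap) =
  subst (_≤ G) (sym h-even) h≤G ,
  subst₂ (λ u v → + N * (G - u) ≤ G * v) (sym h-even) (square-neg s) gap
  where
  square-neg : ∀ s → s * s ≡ - s * - s
  square-neg = solve-∀

paths-near-peak : ∀ N r d → NearPeak N (paths N (+ r)) (paths N) (+ r + + 2 * + d)
paths-near-peak N r zero =
  subst (NearPeak N G (paths N)) (sym (+-identityʳ (+ r)))
    (≤-refl , subst (_≤ G * (+ r * + r)) (sym no-gap) (*-≥0 (paths-nonneg N (+ r)) (square-≥0 (+ r))))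
  where
  G = paths N (+ r)
  no-gap : + N * (G - G) ≡ 0ℤ
  no-gap = trans (cong (+ N *_) (+-inverseʳ G)) (*-zeroʳ (+ N))
paths-near-peak N r (suc d) =
  subst (NearPeak N G (paths N)) (sym (next (+ r) (+ d))) (≤-trans (paths-antitone N 0≤s) h≤G , gap′)
  where
  G = paths N (+ r)
  s = + r + + 2 * + d
  0≤s : 0ℤ ≤ s
  0≤s = +-mono-≤ (+≤+ {0} {r} z≤n) (*-≥0 (+≤+ {0} {2} z≤n) (+≤+ {0} {d} z≤n))
  0≤2s+2 : 0ℤ ≤ s + s + + 2
  0≤2s+2 = +-mono-≤ (+-mono-≤ 0≤s 0≤s) (+≤+ {0} {2} z≤n)
  h≤G = proj₁ (paths-near-peak N r d)
  gap = proj₂ (paths-near-peak N r d)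
  next : ∀ r d → r + + 2 * (1ℤ + d) ≡ r + + 2 * d + + 2
  next = solve-∀
  gap′ : + N * (G - paths N (s + + 2)) ≤ G * ((s + + 2) * (s + + 2))
  gap′ = begin
    + N * (G - paths N (s + + 2))                                  ≡⟨ split (+ N) G (paths N s) (paths N (s + + 2)) ⟩
    + N * (G - paths N s) + + N * (paths N s - paths N (s + + 2))  ≤⟨ +-mono-≤ gap (paths-decrement N 0≤s) ⟩
    G * (s * s) + (s + s + + 2) * paths N s                        ≤⟨ +-monoʳ-≤ (G * (s * s)) (*-monoˡ-≤-≥0 0≤2s+2 h≤G) ⟩
    G * (s * s) + (s + s + + 2) * G                                ≤⟨ ≤-by-gap (G * (s + s + + 2)) (complete G s) (*-≥0 (paths-nonneg N (+ r)) 0≤2s+2) ⟩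
    G * ((s + + 2) * (s + + 2))                                    ∎
    where
    open ≤-Reasoning
    split : ∀ n G p q → n * (G - q) ≡ n * (G - p) + n * (p - q)
    split = solve-∀
    complete : ∀ G s → G * ((s + + 2) * (s + + 2)) ≡ G * (s * s) + (s + s + + 2) * G + G * (s + s + + 2)
    complete = solve-∀

paths-near-peak-ℤ : ∀ N r → r ℕ.< 2 → ∀ t → NearPeak N (paths N (+ r)) (paths N) (+ r + + 2 * t)
paths-near-peak-ℤ N 0 _ (+ d) = paths-near-peak N 0 d
paths-near-peak-ℤ N 0 _ -[1+ d ] =
  subst (NearPeak N _ (paths N)) (reflect (+ suc d)) (NearPeak-neg {N} {h = paths N} (paths-even N _) (paths-near-peak N 0 (suc d)))
  where
  reflect : ∀ x → - (0ℤ + + 2 * x) ≡ 0ℤ + + 2 * - x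
  reflect = solve-∀
paths-near-peak-ℤ N 1 _ (+ d) = paths-near-peak N 1 d
paths-near-peak-ℤ N 1 _ -[1+ d ] =
  subst (NearPeak N _ (paths N)) (reflect (+ d)) (NearPeak-neg {N} {h = paths N} (paths-even N _) (paths-near-peak N 1 d))
  where
  reflect : ∀ x → - (1ℤ + + 2 * x) ≡ 1ℤ + + 2 * - (1ℤ + x)
  reflect = solve-∀
paths-near-peak-ℤ N (suc (suc _)) (s≤s (s≤s ())) _

module Variance (m N : ℕ) (G : ℤ) (h : ℤ → ℤ) (near : ∀ k → NearPeak N G h (+ m + + 2 * k))
                (0<N : 0ℤ < + N) (2m≤N : 2 ℕ.* m ℕ.≤ N) (1≤G : 1ℤ ≤ G) where

  a S₁ S₂ T₁ T₂ : ℤ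
  a = (+ 2) ^ m
  S₁ = walk m h 0ℤ
  S₂ = walk m (λ s → h s * h s) 0ℤ
  T₁ = walk m (λ s → G - h s) 0ℤ
  T₂ = walk m (λ s → (G - h s) * (G - h s)) 0ℤ

  private
    0≤G : 0ℤ ≤ G
    0≤G = ≤-trans (+≤+ z≤n) 1≤G

    0≤a : 0ℤ ≤ a
    0≤a = ≤-trans (+≤+ z≤n) (1≤2^ m)

    0≤N : 0ℤ ≤ + N
    0≤N = +≤+ z≤n

    0≤D : ∀ k → 0ℤ ≤ G - h (+ m + + 2 * k)
    0≤D k = i≤j⇒0≤j-i (proj₁ (near k))

  T₁-bound : + N * T₁ ≤ G * (a * + m)
  T₁-bound = subst₂ _≤_ (walk-*ˡ m (+ N) _ 0ℤ) (trans (walk-*ˡ m G _ 0ℤ) (cong (G *_) (walk-square m 0ℤ)))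
               (walk-mono m 0ℤ (λ k → proj₂ (near k)))

  T₂-bound : + N * + N * T₂ ≤ G * G * (a * (+ 3 * + m * + m - + 2 * + m))
  T₂-bound = subst₂ _≤_ (walk-*ˡ m (+ N * + N) _ 0ℤ)
                        (trans (walk-*ˡ m (G * G) _ 0ℤ) (cong (λ u → G * G * u) (trans (walk-fourth m 0ℤ) (at-0 a (+ m)))))
               (walk-mono m 0ℤ (λ k → subst₂ _≤_ (squares (+ N) _) (squares G _)
                 (*-mono-≤-≥0 (*-≥0 0≤N (0≤D k)) (*-≥0 0≤N (0≤D k)) (proj₂ (near k)) (proj₂ (near k)))))
    where
    squares : ∀ x y → x * y * (x * y) ≡ x * x * (y * y)
    squares = solve-∀
    at-0 : ∀ a m → a * (0ℤ * 0ℤ * (0ℤ * 0ℤ) + + 6 * m * (0ℤ * 0ℤ) + + 3 * m * m - + 2 * m) ≡ a * (+ 3 * m * m - + 2 * m)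
    at-0 = solve-∀

  -- S₁ = a G − T₁, and N T₁ ≤ G a m ≤ N a G / 2.
  mean-lower : a * G ≤ + 2 * S₁
  mean-lower = *-cancelˡ-≤-pos _ _ (+ N) ⦃ positive 0<N ⦄
    (≤-by-gap _ expansion (+-mono-≤ (*-≥0 (*-≥0 0≤a 0≤G) 0≤N-2m) (*-≥0 (+≤+ {0} {2} z≤n) (i≤j⇒0≤j-i T₁-bound))))
    where
    0≤N-2m : 0ℤ ≤ + N - + 2 * + m
    0≤N-2m = i≤j⇒0≤j-i (subst (_≤ + N) (pos-* 2 m) (+≤+ 2m≤N))
    rearrange : ∀ n a g s m → n * (+ 2 * s) ≡ n * (a * g) + (a * g * (n - + 2 * m) + + 2 * (g * (a * m) - n * (a * g - s)))
    rearrange = solve-∀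
    expansion : + N * (+ 2 * S₁) ≡ + N * (a * G) + (a * G * (+ N - + 2 * + m) + + 2 * (G * (a * + m) - + N * T₁))
    expansion = trans (rearrange (+ N) a G S₁ (+ m))
      (cong (λ u → + N * (a * G) + (a * G * (+ N - + 2 * + m) + + 2 * (G * (a * + m) - + N * u))) (sym (walk-const-sub m h G 0ℤ)))

  S₁-pos : 1ℤ ≤ S₁
  S₁-pos = 1≤2x⇒1≤x S₁ (≤-trans (*-mono-≤-≥0 (+≤+ z≤n) (+≤+ z≤n) (1≤2^ m) 1≤G) mean-lower)

  private
    0≤aG : 0ℤ ≤ a * G
    0≤aG = *-≥0 0≤a 0≤G

    [aG]²≤[2S₁]² : a * G * (a * G) ≤ + 2 * S₁ * (+ 2 * S₁)
    [aG]²≤[2S₁]² = *-mono-≤-≥0 0≤aG 0≤aG mean-lower mean-lower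

  variance-upper : + N * + N * (a * S₂ - S₁ * S₁) ≤ + 12 * (+ m * + m) * (S₁ * S₁)
  variance-upper = begin
    + N * + N * (a * S₂ - S₁ * S₁)                 ≡⟨ cong (+ N * + N *_) (walk-variance-shift m h G 0ℤ) ⟩
    + N * + N * (a * T₂ - T₁ * T₁)                 ≤⟨ *-monoˡ-≤-≥0 (*-≥0 0≤N 0≤N) (≤-by-gap (T₁ * T₁) (restore (a * T₂) (T₁ * T₁)) (square-≥0 T₁)) ⟩
    + N * + N * (a * T₂)                           ≡⟨ swap (+ N * + N) a T₂ ⟩
    a * (+ N * + N * T₂)                           ≤⟨ *-monoˡ-≤-≥0 0≤a T₂-bound ⟩
    a * (G * G * (a * (+ 3 * + m * + m - + 2 * + m))) ≤⟨ ≤-by-gap (+ 2 * + m * (a * G * (a * G))) (drop-linear a G (+ m)) (*-≥0 (*-≥0 (+≤+ {0} {2} z≤n) (+≤+ {0} {m} z≤n)) (square-≥0 (a * G))) ⟩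
    + 3 * (+ m * + m) * (a * G * (a * G))          ≤⟨ *-monoˡ-≤-≥0 (*-≥0 (+≤+ {0} {3} z≤n) (square-≥0 (+ m))) [aG]²≤[2S₁]² ⟩
    + 3 * (+ m * + m) * (+ 2 * S₁ * (+ 2 * S₁))    ≡⟨ collect (+ m) S₁ ⟩
    + 12 * (+ m * + m) * (S₁ * S₁)                 ∎
    where
    open ≤-Reasoning
    restore : ∀ x y → x ≡ x - y + y
    restore = solve-∀
    swap : ∀ x a t → x * (a * t) ≡ a * (x * t)
    swap = solve-∀
    drop-linear : ∀ a g m → + 3 * (m * m) * (a * g * (a * g)) ≡ a * (g * g * (a * (+ 3 * m * m - + 2 * m))) + + 2 * m * (a * g * (a * g))
    drop-linear = solve-∀
    collect : ∀ m s → + 3 * (m * m) * (+ 2 * s * (+ 2 * s)) ≡ + 12 * (m * m) * (s * s)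
    collect = solve-∀

  variance-lower : + N * + N * - (a * S₂ - S₁ * S₁) ≤ + 4 * (+ m * + m) * (S₁ * S₁)
  variance-lower = begin
    + N * + N * - (a * S₂ - S₁ * S₁)               ≡⟨ cong (λ u → + N * + N * - u) (walk-variance-shift m h G 0ℤ) ⟩
    + N * + N * - (a * T₂ - T₁ * T₁)               ≤⟨ *-monoˡ-≤-≥0 (*-≥0 0≤N 0≤N) (≤-by-gap (a * T₂) (restore a T₂ T₁) (*-≥0 0≤a T₂-nonneg)) ⟩
    + N * + N * (T₁ * T₁)                          ≡⟨ regroup (+ N) T₁ ⟩
    + N * T₁ * (+ N * T₁)                          ≤⟨ *-mono-≤-≥0 (*-≥0 0≤N T₁-nonneg) (*-≥0 0≤N T₁-nonneg) T₁-bound T₁-bound ⟩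
    G * (a * + m) * (G * (a * + m))                ≡⟨ factor G a (+ m) ⟩
    + m * + m * (a * G * (a * G))                  ≤⟨ *-monoˡ-≤-≥0 (square-≥0 (+ m)) [aG]²≤[2S₁]² ⟩
    + m * + m * (+ 2 * S₁ * (+ 2 * S₁))            ≡⟨ collect (+ m) S₁ ⟩
    + 4 * (+ m * + m) * (S₁ * S₁)                  ∎
    where
    open ≤-Reasoning
    T₁-nonneg : 0ℤ ≤ T₁
    T₁-nonneg = walk-nonneg m 0ℤ 0≤D
    T₂-nonneg : 0ℤ ≤ T₂
    T₂-nonneg = walk-nonneg m 0ℤ (λ k → square-≥0 (G - h (+ m + + 2 * k)))
    restore : ∀ a t₂ t₁ → t₁ * t₁ ≡ - (a * t₂ - t₁ * t₁) + a * t₂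
    restore = solve-∀
    regroup : ∀ n t → n * n * (t * t) ≡ n * t * (n * t)
    regroup = solve-∀
    factor : ∀ g a m → g * (a * m) * (g * (a * m)) ≡ m * m * (a * g * (a * g))
    factor = solve-∀
    collect : ∀ m s → m * m * (+ 2 * s * (+ 2 * s)) ≡ + 4 * (m * m) * (s * s)
    collect = solve-∀

  variance-bound : + N * + N * + ∣ a * S₂ - S₁ * S₁ ∣ ≤ + 12 * (+ m * + m) * (S₁ * S₁)
  variance-bound = *-∣∣-≤ {+ N * + N} (a * S₂ - S₁ * S₁) variance-upper
    (≤-trans variance-lower (*-monoʳ-≤-≥0 (square-≥0 S₁) (*-monoʳ-≤-≥0 (square-≥0 (+ m)) (+≤+ (ℕ.m≤m+n 4 8)))))

count-Ω : ∀ n → + length (Ω n) ≡ (+ 2) ^ n * (+ 2) ^ n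
count-Ω n = begin
  + length (Ω n)                                         ≡⟨ length-∑ (Ω n) ⟩
  ∑ (λ _ → 1ℤ) (Ω n)                                     ≡⟨ ∑-Ω n (λ _ → 1ℤ) ⟩
  ∑ (λ _ → ∑ (λ _ → 1ℤ) (signs n)) (signs n)             ≡⟨ ∑-cong (λ _ → ∑-signs-const n 1ℤ) (signs n) ⟩
  ∑ (λ _ → (+ 2) ^ n * 1ℤ) (signs n)                     ≡⟨ ∑-signs-const n _ ⟩
  (+ 2) ^ n * ((+ 2) ^ n * 1ℤ)                           ≡⟨ cong ((+ 2) ^ n *_) (*-identityʳ _) ⟩
  (+ 2) ^ n * (+ 2) ^ n                                  ∎
  where open ≡-Reasoning

count-E₁ : ∀ m N → + count E₁ (Ω (m ℕ.+ N)) ≡ (+ 2) ^ (m ℕ.+ N) * walk m (paths N) 0ℤ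
count-E₁ m N = begin
  + count E₁ (Ω n)                                       ≡⟨ count-∑ E₁ (Ω n) ⟩
  ∑ (𝟙 ∘ E₁) (Ω n)                                       ≡⟨ ∑-Ω n (𝟙 ∘ E₁) ⟩
  ∑ (λ xs → ∑ (λ _ → δ (sumℤ xs)) (signs n)) (signs n)   ≡⟨ ∑-cong (λ xs → ∑-signs-const n (δ (sumℤ xs))) (signs n) ⟩
  ∑ (λ xs → (+ 2) ^ n * δ (sumℤ xs)) (signs n)           ≡⟨ ∑-*ˡ ((+ 2) ^ n) (δ ∘ sumℤ) (signs n) ⟩
  (+ 2) ^ n * ∑ (δ ∘ sumℤ) (signs n)                     ≡⟨ cong ((+ 2) ^ n *_) (∑-signs-sum n δ) ⟩
  (+ 2) ^ n * walk n δ 0ℤ                                ≡⟨ cong ((+ 2) ^ n *_) (walk-compose m N δ 0ℤ) ⟩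
  (+ 2) ^ n * walk m (paths N) 0ℤ                        ∎
  where
  open ≡-Reasoning
  n = m ℕ.+ N

count-Eboth : ∀ m N → + count (Eboth m) (Ω (m ℕ.+ N)) ≡ (+ 2) ^ m * walk m (λ s → paths N s * paths N s) 0ℤ
count-Eboth m N = begin
  + count (Eboth m) (Ω n)
    ≡⟨ count-∑ (Eboth m) (Ω n) ⟩
  ∑ (𝟙 ∘ Eboth m) (Ω n)
    ≡⟨ ∑-Ω n (𝟙 ∘ Eboth m) ⟩
  ∑ (λ xs → ∑ (λ ys → 𝟙 (Eboth m (xs , ys))) (signs n)) (signs n)
    ≡⟨ ∑-cong (λ xs → ∑-cong (λ ys → 𝟙-∧ (E₁ (xs , ys)) (E₂ m (xs , ys))) (signs n)) (signs n) ⟩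
  ∑ (λ xs → ∑ (λ ys → δ (sumℤ xs) * δ (sumℤ (take m xs ++ drop m ys))) (signs n)) (signs n)
    ≡⟨ ∑-cong (λ xs → ∑-*ˡ (δ (sumℤ xs)) (λ ys → δ (sumℤ (take m xs ++ drop m ys))) (signs n)) (signs n) ⟩
  ∑ (λ xs → δ (sumℤ xs) * ∑ (λ ys → δ (sumℤ (take m xs ++ drop m ys))) (signs n)) (signs n)
    ≡⟨ ∑-cong (λ xs → cong (δ (sumℤ xs) *_) (∑-signs-replace-prefix m N δ (take m xs))) (signs n) ⟩
  ∑ (λ xs → δ (sumℤ xs) * ((+ 2) ^ m * paths N (sumℤ (take m xs)))) (signs n)
    ≡⟨ ∑-signs-take m N (λ s t → δ t * ((+ 2) ^ m * paths N s)) ⟩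
  walk m (λ s → walk N (λ t → δ t * ((+ 2) ^ m * paths N s)) s) 0ℤ
    ≡⟨ walk-cong m (λ s → trans (walk-cong N (λ t → *-comm (δ t) ((+ 2) ^ m * paths N s)) s) (walk-*ˡ N ((+ 2) ^ m * paths N s) δ s)) 0ℤ ⟩
  walk m (λ s → (+ 2) ^ m * paths N s * paths N s) 0ℤ
    ≡⟨ walk-cong m (λ s → *-assoc ((+ 2) ^ m) (paths N s) (paths N s)) 0ℤ ⟩
  walk m (λ s → (+ 2) ^ m * (paths N s * paths N s)) 0ℤ
    ≡⟨ walk-*ˡ m ((+ 2) ^ m) _ 0ℤ ⟩
  (+ 2) ^ m * walk m (λ s → paths N s * paths N s) 0ℤ ∎
  where
  open ≡-Reasoning
  n = m ℕ.+ N

frac-ᵘ : ∀ a L → toℚᵘ (frac a (suc L)) ℚᵘ.≃ mkℚᵘ (+ a) L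
frac-ᵘ a L = ℚ.toℚᵘ-fromℚᵘ (mkℚᵘ (+ a) L)

Pr-ᵘ : (xs : List X) (E : X → Bool) {L : ℕ} → length xs ≡ suc L → toℚᵘ (Pr xs E) ℚᵘ.≃ mkℚᵘ (+ count E xs) L
Pr-ᵘ xs E {L} eq = ℚᵘ.≃-trans (ℚ.toℚᵘ-cong (cong (frac (count E xs)) eq)) (frac-ᵘ (count E xs) L)

numerator-pos : ∀ q a d → toℚᵘ q ℚᵘ.≃ mkℚᵘ (+ suc a) d → ∃[ k ] ℚ.↥ q ≡ + suc k
numerator-pos (mkℚ (+ suc k) _ _) a d _ = k , refl
numerator-pos (mkℚ (+ zero) _ _) a d (*≡* ())
numerator-pos (mkℚ -[1+ k ] _ _) a d (*≡* ())

↧/↥-inverse : ∀ q k → ℚ.↥ q ≡ + suc k → (ℚ.↧ q ℚ./ suc k) ℚ.* q ≡ 1ℚ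
↧/↥-inverse q@(mkℚ _ d c) k refl =
  trans (cong (ℚ._* q) (ℚ.normalize-coprime (Coprime.sym c))) (ℚ.*-inverseˡ q)

deviation-ᵘ : ∀ (x : ℚᵘ) (a L B k : ℕ) (c : ℤ) →
  x ℚᵘ.* (mkℚᵘ (+ suc a) L ℚᵘ.* mkℚᵘ (+ suc a) L) ℚᵘ.≃ mkℚᵘ (+ B) L →
  + k * + ∣ + B * + suc L - + suc a * + suc a ∣ ≤ c * (+ suc a * + suc a) →
  ℚᵘ.∣ x ℚᵘ.- ℚᵘ.1ℚᵘ ∣ ℚᵘ.* mkℚᵘ (+ k) 0 ℚᵘ.≤ mkℚᵘ c 0
deviation-ᵘ (mkℚᵘ p d) a L B k c (*≡* eq) bound = *≤* (begin
  + ∣ w ∣ * + k * 1ℤ                          ≡⟨ *-identityʳ _ ⟩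
  + ∣ w ∣ * + k                               ≤⟨ *-cancelˡ-≤-pos _ _ A² A²-bound ⟩
  c * + suc d                                 ≡⟨ cong (λ z → c * + z) (sym (trans (ℕ.*-identityʳ _) (ℕ.*-identityʳ _))) ⟩
  c * + (suc d ℕ.* 1 ℕ.* 1)                   ∎)
  where
  open ≤-Reasoning
  A² = + suc a * + suc a
  D = + suc d
  Λ = + suc L
  w = p * 1ℤ + -1ℤ * D
  cross : p * A² ≡ + B * Λ * D
  cross = *-cancelʳ-≡ _ _ Λ (trans eq (rearrange (+ B) D Λ))
    where
    rearrange : ∀ b d l → b * (d * (l * l)) ≡ b * l * d * l
    rearrange = solve-∀
  A²w : A² * w ≡ D * (+ B * Λ - A²)
  A²w = trans (expand p A² D) (trans (cong (_- A² * D) cross) (factor (+ B * Λ) D A²))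
    where
    expand : ∀ p a d → a * (p * 1ℤ + -1ℤ * d) ≡ p * a - a * d
    expand = solve-∀
    factor : ∀ x d a → x * d - a * d ≡ d * (x - a)
    factor = solve-∀
  A²∣w∣ : A² * + ∣ w ∣ ≡ D * + ∣ + B * Λ - A² ∣
  A²∣w∣ = begin-equality
    A² * + ∣ w ∣                ≡⟨ pos-* ∣ A² ∣ ∣ w ∣ ⟨
    + (∣ A² ∣ ℕ.* ∣ w ∣)        ≡⟨ cong +_ (abs-* A² w) ⟨
    + ∣ A² * w ∣               ≡⟨ cong (+_ ∘ ∣_∣) A²w ⟩
    + ∣ D * (+ B * Λ - A²) ∣    ≡⟨ cong +_ (abs-* D (+ B * Λ - A²)) ⟩
    + (suc d ℕ.* ∣ + B * Λ - A² ∣) ≡⟨ pos-* (suc d) _ ⟩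
    D * + ∣ + B * Λ - A² ∣      ∎
  A²-bound : A² * (+ ∣ w ∣ * + k) ≤ A² * (c * D)
  A²-bound = begin
    A² * (+ ∣ w ∣ * + k)        ≡⟨ *-assoc A² (+ ∣ w ∣) (+ k) ⟨
    A² * + ∣ w ∣ * + k          ≡⟨ cong (_* + k) A²∣w∣ ⟩
    D * + ∣ + B * Λ - A² ∣ * + k ≡⟨ swap D _ (+ k) ⟩
    D * (+ k * + ∣ + B * Λ - A² ∣) ≤⟨ *-monoˡ-≤-nonNeg D bound ⟩
    D * (c * A²)                ≡⟨ swap′ D c A² ⟩
    A² * (c * D)                ∎
    where
    swap : ∀ d x k → d * x * k ≡ d * (k * x)
    swap = solve-∀
    swap′ : ∀ d c a → d * (c * a) ≡ a * (c * d)
    swap′ = solve-∀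

module _ (n m : ℕ) where

  private
    q P Q : ℚ
    q = Pr (Ω n) E₁
    P = Pr (Ω n) (Eboth m)
    Q = q ℚ.* q
    A B L : ℕ
    A = count E₁ (Ω n)
    B = count (Eboth m) (Ω n)
    L = length (Ω n)

  -- α is defined by a with on ↥ Q; abstracting ↥ Q here lets that definition compute.
  α-unfold : ∀ k → ℚ.↥ Q ≡ + suc k → α n m ≡ P ℚ.* (ℚ.↧ Q ℚ./ suc k)
  α-unfold k eq with ℚ.↥ Q
  α-unfold k refl | .(+ suc k) = refl

  α-inverse : ∀ k → ℚ.↥ Q ≡ + suc k → α n m ℚ.* Q ≡ P
  α-inverse k eq = begin
    α n m ℚ.* Q                      ≡⟨ cong (ℚ._* Q) (α-unfold k eq) ⟩
    P ℚ.* (ℚ.↧ Q ℚ./ suc k) ℚ.* Q    ≡⟨ ℚ.*-assoc P _ Q ⟩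
    P ℚ.* ((ℚ.↧ Q ℚ./ suc k) ℚ.* Q)  ≡⟨ cong (P ℚ.*_) (↧/↥-inverse Q k eq) ⟩
    P ℚ.* 1ℚ                         ≡⟨ ℚ.*-identityʳ P ⟩
    P                                ∎
    where open ≡-Reasoning


  α-deviation : ∀ k c₁ c₂ → 0 ℕ.< A →
                + k * + ∣ + B * + L - + A * + A ∣ ≤ + c₁ * + c₂ * (+ A * + A) →
                ℚ.∣ α n m ℚ.- 1ℚ ∣ ℚ.* frac k 1 ℚ.≤ frac c₁ 1 ℚ.* frac c₂ 1
  α-deviation k c₁ c₂ 0<A bound =
    ℚ.toℚᵘ-cancel-≤ (ℚᵘ.≤-respˡ-≃ (ℚᵘ.≃-sym lhs) (ℚᵘ.≤-respʳ-≃ (ℚᵘ.≃-sym rhs)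
      (deviation-ᵘ (toℚᵘ (α n m)) a L′ B k (+ c₁ * + c₂) α-ᵘ bound′)))
    where
    a = ℕ.pred A
    L′ = ℕ.pred L
    A≡ : suc a ≡ A
    A≡ = ℕ.suc-pred A ⦃ ℕ.>-nonZero 0<A ⦄
    L≡ : suc L′ ≡ L
    L≡ = ℕ.suc-pred L ⦃ ℕ.>-nonZero (ℕ.<-≤-trans 0<A (length-filter (T? ∘ E₁) (Ω n))) ⦄
    q-ᵘ : toℚᵘ q ℚᵘ.≃ mkℚᵘ (+ suc a) L′
    q-ᵘ = subst (λ x → toℚᵘ q ℚᵘ.≃ mkℚᵘ (+ x) L′) (sym A≡) (Pr-ᵘ (Ω n) E₁ (sym L≡))
    Q-ᵘ : toℚᵘ Q ℚᵘ.≃ mkℚᵘ (+ suc a) L′ ℚᵘ.* mkℚᵘ (+ suc a) L′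
    Q-ᵘ = ℚᵘ.≃-trans (ℚ.toℚᵘ-homo-* q q) (ℚᵘ.*-cong q-ᵘ q-ᵘ)
    α-ᵘ : toℚᵘ (α n m) ℚᵘ.* (mkℚᵘ (+ suc a) L′ ℚᵘ.* mkℚᵘ (+ suc a) L′) ℚᵘ.≃ mkℚᵘ (+ B) L′
    α-ᵘ = begin-equality
      toℚᵘ (α n m) ℚᵘ.* (mkℚᵘ (+ suc a) L′ ℚᵘ.* mkℚᵘ (+ suc a) L′) ≃⟨ ℚᵘ.*-congˡ {toℚᵘ (α n m)} Q-ᵘ ⟨
      toℚᵘ (α n m) ℚᵘ.* toℚᵘ Q                                      ≃⟨ ℚ.toℚᵘ-homo-* (α n m) Q ⟨
      toℚᵘ (α n m ℚ.* Q)                                            ≡⟨ cong toℚᵘ (α-inverse (proj₁ ↥Q-pos) (proj₂ ↥Q-pos)) ⟩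
      toℚᵘ P                                                        ≃⟨ Pr-ᵘ (Ω n) (Eboth m) (sym L≡) ⟩
      mkℚᵘ (+ B) L′                                                 ∎
      where
      open ℚᵘ.≤-Reasoning
      ↥Q-pos = numerator-pos Q _ _ Q-ᵘ
    lhs : toℚᵘ (ℚ.∣ α n m ℚ.- 1ℚ ∣ ℚ.* frac k 1) ℚᵘ.≃ ℚᵘ.∣ toℚᵘ (α n m) ℚᵘ.- ℚᵘ.1ℚᵘ ∣ ℚᵘ.* mkℚᵘ (+ k) 0
    lhs = ℚᵘ.≃-trans (ℚ.toℚᵘ-homo-* (ℚ.∣ α n m ℚ.- 1ℚ ∣) (frac k 1))
            (ℚᵘ.*-cong (ℚᵘ.≃-trans (ℚ.toℚᵘ-homo-∣-∣ (α n m ℚ.- 1ℚ)) (ℚᵘ.∣-∣-cong (ℚ.toℚᵘ-homo-+ (α n m) (ℚ.- 1ℚ)))) (frac-ᵘ k 0))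
    rhs : toℚᵘ (frac c₁ 1 ℚ.* frac c₂ 1) ℚᵘ.≃ mkℚᵘ (+ c₁ * + c₂) 0
    rhs = ℚᵘ.≃-trans (ℚ.toℚᵘ-homo-* (frac c₁ 1) (frac c₂ 1)) (ℚᵘ.*-cong (frac-ᵘ c₁ 0) (frac-ᵘ c₂ 0))
    bound′ : + k * + ∣ + B * + suc L′ - + suc a * + suc a ∣ ≤ + c₁ * + c₂ * (+ suc a * + suc a)
    bound′ = subst₂ (λ x y → + k * + ∣ + B * + y - + x * + x ∣ ≤ + c₁ * + c₂ * (+ x * + x)) (sym A≡) (sym L≡) bound

DeviationBound : ℕ → ℕ → Set
DeviationBound n m = ℚ.∣ α n m ℚ.- 1ℚ ∣ ℚ.* frac (n ℕ.* n) 1 ℚ.≤ frac 48 1 ℚ.* frac (m ℕ.* m) 1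

deviation-from-walks : ∀ m N →
  let n = m ℕ.+ N
      S₁ = walk m (paths N) 0ℤ
      S₂ = walk m (λ s → paths N s * paths N s) 0ℤ
  in 1ℤ ≤ S₁ → + (n ℕ.* n) * + ∣ (+ 2) ^ m * S₂ - S₁ * S₁ ∣ ≤ + 48 * + (m ℕ.* m) * (S₁ * S₁) →
     DeviationBound n m
deviation-from-walks m N 1≤S₁ bound = α-deviation n m (n ℕ.* n) 48 (m ℕ.* m) 0<#E₁ (begin
  + k * + ∣ + #E₁₂ * + #Ω - + #E₁ * + #E₁ ∣  ≡⟨ cong (λ x → + k * + ∣ x ∣) counts-V ⟩
  + k * + ∣ t * t * V ∣                      ≡⟨ cong (+ k *_) (+∣*∣ (t * t) V (square-≥0 t)) ⟩
  + k * (t * t * + ∣ V ∣)                    ≡⟨ swap (+ k) (t * t) (+ ∣ V ∣) ⟩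
  t * t * (+ k * + ∣ V ∣)                    ≤⟨ *-monoˡ-≤-≥0 (square-≥0 t) bound ⟩
  t * t * (+ 48 * + (m ℕ.* m) * (S₁ * S₁))   ≡⟨ regroup (+ 48 * + (m ℕ.* m)) S₁ t ⟩
  + 48 * + (m ℕ.* m) * (t * S₁ * (t * S₁))   ≡⟨ cong (λ x → + 48 * + (m ℕ.* m) * (x * x)) (count-E₁ m N) ⟨
  + 48 * + (m ℕ.* m) * (+ #E₁ * + #E₁)       ∎)
  where
  open ≤-Reasoning
  n = m ℕ.+ N
  k = n ℕ.* n
  t = (+ 2) ^ n
  S₁ = walk m (paths N) 0ℤ
  S₂ = walk m (λ s → paths N s * paths N s) 0ℤ
  V = (+ 2) ^ m * S₂ - S₁ * S₁
  #Ω = length (Ω n)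
  #E₁ = count E₁ (Ω n)
  #E₁₂ = count (Eboth m) (Ω n)
  0<#E₁ : 0 ℕ.< #E₁
  0<#E₁ = drop‿+≤+ (subst (1ℤ ≤_) (sym (count-E₁ m N)) (*-mono-≤-≥0 (+≤+ z≤n) (+≤+ z≤n) (1≤2^ n) 1≤S₁))
  swap : ∀ k u x → k * (u * x) ≡ u * (k * x)
  swap = solve-∀
  regroup : ∀ c s t → t * t * (c * (s * s)) ≡ c * (t * s * (t * s))
  regroup = solve-∀
  factor : ∀ a s₂ t s₁ → a * s₂ * (t * t) - t * s₁ * (t * s₁) ≡ t * t * (a * s₂ - s₁ * s₁)
  factor = solve-∀
  counts-V : + #E₁₂ * + #Ω - + #E₁ * + #E₁ ≡ t * t * V
  counts-V = trans (cong₂ (λ u v → u * v - + #E₁ * + #E₁) (count-Eboth m N) (count-Ω n))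
               (trans (cong (λ x → (+ 2) ^ m * S₂ * (t * t) - x * x) (count-E₁ m N)) (factor ((+ 2) ^ m) S₂ t S₁))

parity-split : ∀ N → + N ≡ + (N ℕ.% 2) + + 2 * + (N ℕ./ 2)
parity-split N = trans (cong +_ (trans (m≡m%n+[m/n]*n N 2) (cong (N ℕ.% 2 ℕ.+_) (ℕ.*-comm (N ℕ./ 2) 2))))
                       (cong (_+_ (+ (N ℕ.% 2))) (pos-* 2 (N ℕ./ 2)))

1≤paths-peak : ∀ N → 1ℤ ≤ paths N (+ (N ℕ.% 2))
1≤paths-peak N = ≤-trans (paths-top N)
  (subst (λ s → paths N s ≤ paths N (+ (N ℕ.% 2))) (sym (parity-split N)) (proj₁ (paths-near-peak N (N ℕ.% 2) (N ℕ./ 2))))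

paths-near-peak-reachable : ∀ m N → 2 ∣ m ℕ.+ N → ∀ k → NearPeak N (paths N (+ (N ℕ.% 2))) (paths N) (+ m + + 2 * k)
paths-near-peak-reachable m N (divides q m+N≡q*2) k =
  subst (NearPeak N _ (paths N)) (sym reachable) (paths-near-peak-ℤ N r (m%n<n N 2) (+ q - + d - + r + k))
  where
  open ≡-Reasoning
  r = N ℕ.% 2
  d = N ℕ./ 2
  reachable : + m + + 2 * k ≡ + r + + 2 * (+ q - + d - + r + k)
  reachable = begin
    + m + + 2 * k                            ≡⟨ shift (+ m) (+ N) k ⟩
    + m + + N - + N + + 2 * k                ≡⟨ cong₂ (λ u v → u - v + + 2 * k) (trans (cong +_ m+N≡q*2) (pos-* q 2)) (parity-split N) ⟩
    + q * + 2 - (+ r + + 2 * + d) + + 2 * k  ≡⟨ recentre (+ q) (+ r) (+ d) k ⟩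
    + r + + 2 * (+ q - + d - + r + k)        ∎
    where
    shift : ∀ m N k → m + + 2 * k ≡ m + N - N + + 2 * k
    shift = solve-∀
    recentre : ∀ q r d k → q * + 2 - (r + + 2 * d) + + 2 * k ≡ r + + 2 * (q - d - r + k)
    recentre = solve-∀

deviation-spread : ∀ m N → 2 ∣ m ℕ.+ N → 2 ℕ.* m ℕ.≤ N → 0 ℕ.< N → DeviationBound (m ℕ.+ N) m
deviation-spread m N 2∣n 2m≤N 0<N = deviation-from-walks m N S₁-pos (begin
  + (n ℕ.* n) * + ∣ V ∣                  ≤⟨ *-monoʳ-≤-≥0 (+≤+ z≤n) n²≤4N² ⟩
  + 4 * (+ N * + N) * + ∣ V ∣            ≡⟨ *-assoc (+ 4) (+ N * + N) (+ ∣ V ∣) ⟩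
  + 4 * (+ N * + N * + ∣ V ∣)            ≤⟨ *-monoˡ-≤-≥0 (+≤+ {0} {4} z≤n) variance-bound ⟩
  + 4 * (+ 12 * (+ m * + m) * (S₁ * S₁)) ≡⟨ cong (λ x → + 4 * (+ 12 * x * (S₁ * S₁))) (pos-* m m) ⟨
  + 4 * (+ 12 * + (m ℕ.* m) * (S₁ * S₁)) ≡⟨ collect (+ (m ℕ.* m)) (S₁ * S₁) ⟩
  + 48 * + (m ℕ.* m) * (S₁ * S₁)         ∎)
  where
  open ≤-Reasoning
  open Variance m N (paths N (+ (N ℕ.% 2))) (paths N) (paths-near-peak-reachable m N 2∣n) (+<+ 0<N) 2m≤N (1≤paths-peak N)
  n = m ℕ.+ N
  V = a * S₂ - S₁ * S₁
  n≤2N : n ℕ.≤ 2 ℕ.* N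
  n≤2N = ℕ.+-mono-≤ (ℕ.≤-trans (ℕ.m≤m+n m (m ℕ.+ 0)) 2m≤N) (ℕ.m≤m+n N 0)
  n²≤4N² : + (n ℕ.* n) ≤ + 4 * (+ N * + N)
  n²≤4N² = subst (+ (n ℕ.* n) ≤_) (trans (cong +_ (square-double N)) (trans (pos-* 4 (N ℕ.* N)) (cong (+ 4 *_) (pos-* N N))))
             (+≤+ (ℕ.*-mono-≤ n≤2N n≤2N))
    where
    square-double : ∀ N → 2 ℕ.* N ℕ.* (2 ℕ.* N) ≡ 4 ℕ.* (N ℕ.* N)
    square-double = ℕ-Ring.solve-∀
  collect : ∀ c s → + 4 * (+ 12 * c * s) ≡ + 48 * c * s
  collect = solve-∀

spread-or-small : ∀ m N → 2 ∣ m ℕ.+ N → m ℕ.* m ℕ.≤ m ℕ.+ N → (2 ℕ.* m ℕ.≤ N × 0 ℕ.< N) ⊎ (N ≡ m × m ℕ.≤ 2)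
spread-or-small 0 0 _ _ = inj₂ (refl , z≤n)
spread-or-small 0 (suc N) _ _ = inj₁ (z≤n , s≤s z≤n)
spread-or-small 1 0 2∣1 _ = contradiction 2∣1 (from-no (2 ∣? 1))
spread-or-small 1 1 _ _ = inj₂ (refl , s≤s z≤n)
spread-or-small 1 (suc (suc N)) _ _ = inj₁ (s≤s (s≤s z≤n) , s≤s z≤n)
spread-or-small 2 0 _ (s≤s (s≤s ()))
spread-or-small 2 1 _ (s≤s (s≤s (s≤s ())))
spread-or-small 2 2 _ _ = inj₂ (refl , s≤s (s≤s z≤n))
spread-or-small 2 3 2∣5 _ = contradiction 2∣5 (from-no (2 ∣? 5))
spread-or-small 2 (suc (suc (suc (suc N)))) _ _ = inj₁ (s≤s (s≤s (s≤s (s≤s z≤n))) , s≤s z≤n)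
spread-or-small m@(suc (suc (suc k))) N _ m²≤m+N = inj₁ (2m≤N , ℕ.<-≤-trans (s≤s z≤n) 2m≤N)
  where
  2m≤N : 2 ℕ.* m ℕ.≤ N
  2m≤N = ℕ.+-cancelˡ-≤ m (2 ℕ.* m) N (ℕ.≤-trans (ℕ.*-monoˡ-≤ m {3} {m} (s≤s (s≤s (s≤s z≤n)))) m²≤m+N)

deviation-small : ∀ m → m ℕ.≤ 2 → DeviationBound (m ℕ.+ m) m
deviation-small 0 _ = deviation-from-walks 0 0 (toWitness {a? = _ ≤? _} _) (toWitness {a? = _ ≤? _} _)
deviation-small 1 _ = deviation-from-walks 1 1 (toWitness {a? = _ ≤? _} _) (toWitness {a? = _ ≤? _} _)
deviation-small 2 _ = deviation-from-walks 2 2 (toWitness {a? = _ ≤? _} _) (toWitness {a? = _ ≤? _} _)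
deviation-small (suc (suc (suc _))) (s≤s (s≤s ()))

deviation-bound : ∀ m N → 2 ∣ m ℕ.+ N → m ℕ.* m ℕ.≤ m ℕ.+ N → DeviationBound (m ℕ.+ N) m
deviation-bound m N 2∣n m²≤n with spread-or-small m N 2∣n m²≤n
... | inj₁ (2m≤N , 0<N) = deviation-spread m N 2∣n 2m≤N 0<N
... | inj₂ (refl , m≤2) = deviation-small m m≤2

m≤m*m : ∀ m → m ℕ.≤ m ℕ.* m
m≤m*m zero = z≤n
m≤m*m (suc m) = ℕ.m≤m*n (suc m) (suc m)

lemma4p2 : ∃[ C ] ((n m : ℕ) → 2 ∣ n → m ℕ.* m ℕ.≤ n → ℚ.∣ α n m ℚ.- 1ℚ ∣ ℚ.* frac (n ℕ.* n) 1 ℚ.≤ C ℚ.* frac (m ℕ.* m) 1)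
lemma4p2 = frac 48 1 , λ n m 2∣n m²≤n →
  let n≡m+N = sym (ℕ.m+[n∸m]≡n (ℕ.≤-trans (m≤m*m m) m²≤n)) in
  subst (λ n → DeviationBound n m) (sym n≡m+N)
    (deviation-bound m (n ℕ.∸ m) (subst (2 ∣_) n≡m+N 2∣n) (subst (m ℕ.* m ℕ.≤_) n≡m+N m²≤n))
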